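{- Let $A$ and $B$ be two $m\times n$ matrices (with entries from some set) that have the same multiset of entries. Then there exist $m\times n$ matrices $A'$ and $B'$ such that: (i) for each $1\le i\le m$, the multiset of entries of the $i$-th row of $A'$ equals the multiset of entries of the $i$-th row of $B'$; and (ii) for each $1\le j\le n$, the multiset of entries of the $j$-th column of $A'$ equals that of the $j$-th column of $A$, and the multiset of entries of the $j$-th column of $B'$ equals that of the $j$-th column of $B$. -}

module Defs where

open import Data.Nat using (ℕ)
open import Data.Fin using (Fin)
open import Data.List using (List; tabulate; concat)
open import Data.List.Relation.Binary.Permutation.Propositional using (_↭_)

Matrix : ∀ {a} → Set a → ℕ → ℕ → Set a
Matrix A m n = Fin m → Fin n → A

row : ∀ {a} {A : Set a} {m n : ℕ} → Matrix A m n → Fin m → List A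
row M i = tabulate (λ j → M i j)

col : ∀ {a} {A : Set a} {m n : ℕ} → Matrix A m n → Fin n → List A
col M j = tabulate (λ i → M i j)

entries : ∀ {a} {A : Set a} {m n : ℕ} → Matrix A m n → List A
entries M = concat (tabulate (row M))

SameMultiset : ∀ {a} {A : Set a} → List A → List A → Set a
SameMultiset xs ys = xs ↭ ys

-- Index the entries of P by N = m n edges; the permutation entries P ↭ entries Q matches
-- each edge with an entry of Q as well.  An edge then joins the column of P it lies in to
-- the column of Q it lies in, giving a bipartite multigraph in which every vertex has degree
-- m.  By Kőnig's theorem its edges can be coloured with m colours so that the edges at each
-- vertex get distinct colours.  Moving the entry of colour i to row i inside every column of
-- P and of Q keeps the columns and makes row i of both matrices consist of the entries of
-- colour i.
-- The colouring is built edge by edge: if the colour α free at the left end of a new edge is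
-- taken at its right end, where β is free, swapping α and β along the alternating α/β path
-- starting there frees α at the right end without taking it at the left end.

module Submission where

open import Defs
open import Data.Empty using (⊥; ⊥-elim)
open import Data.Fin as Fin using (Fin; zero; suc; punchIn; punchOut; cast; toℕ; fromℕ<; splitAt)
open import Data.Fin.Permutation using (Permutation′; _⟨$⟩ʳ_; _⟨$⟩ˡ_; inverseˡ; transpose; cast-id)
import Data.Fin.Permutation.Components as PC
open import Data.Fin.Properties
  using (any?; 0≢1+n; cast-is-id; punchOut-injective; punchIn-punchOut; suc-injective; injective⇒≤; +↔⊎;
         toℕ≤pred[n]; toℕ-injective; toℕ-fromℕ<)
open import Data.List using (List; []; _∷_; _++_; length; lookup; tabulate; allFin)
open import Data.List.Properties using (length-tabulate; length-++)
open import Data.List.Membership.Propositional.Properties using (∈-allFin)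
open import Data.List.Relation.Binary.Permutation.Propositional
  using (_↭_; ↭-refl; ↭-prep; ↭-swap; ↭-trans; ↭-sym; ↭-reflexive; ↭⇒↭ₛ)
import Data.List.Relation.Binary.Permutation.Setoid as Perm
import Data.List.Relation.Binary.Permutation.Setoid.Properties as PermProperties
open import Data.List.Relation.Unary.All as All using (All; []; _∷_)
open import Data.Maybe as Maybe using (Maybe; just; nothing)
open import Data.Maybe.Properties using (just-injective; ≡-dec)
open import Data.Nat using (ℕ; zero; suc; _≤_; _<_)
open import Data.Nat.Properties using (<-irrefl; m≤n⇒m<n∨m≡n; ≤-pred)
open import Data.Product using (Σ; ∃; _×_; _,_; proj₁; proj₂; map₁; uncurry; swap)
open import Data.Product.Properties using (×-≡,≡→≡)
open import Data.Sum using (_⊎_; inj₁; inj₂; [_,_]′)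
open import Data.Sum.Properties using ([,]-map)
open import Data.Sum.Function.Propositional using (_⊎-↔_)
open import Function using (_∘_; id; _↔_; Inverse; Injection; mk↔ₛ′)
open import Function.Construct.Composition using (_↔-∘_)
open import Function.Construct.Symmetry using (↔-sym)
open import Function.Definitions using (Injective; StrictlySurjective)
open import Function.Properties.Inverse using (↔⇒↣)
open import Function.Related.TypeIsomorphisms using (×-comm)
open import Relation.Binary.PropositionalEquality
  using (_≡_; _≢_; refl; sym; trans; cong; subst; setoid; module ≡-Reasoning)
open import Relation.Nullary using (¬_; Dec; yes; no; ¬?; contradiction)
open import Relation.Nullary.Decidable using (map′; _×-dec_; _⊎-dec_; decidable-stable; dec-true; dec-false)

open Inverse using (to; from; strictlyInverseˡ; strictlyInverseʳ)
open ≡-Reasoning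

injective⇒strictlySurjective : ∀ {n} {f : Fin n → Fin n} → Injective _≡_ _≡_ f → StrictlySurjective _≡_ f
injective⇒strictlySurjective {suc n} {f} f-inj y with any? (λ x → f x Fin.≟ y)
... | yes hit = hit
... | no miss = ⊥-elim (<-irrefl refl (injective⇒≤ punchOut∘f-injective))
  where
  y≢f : ∀ x → y ≢ f x
  y≢f x y≡fx = miss (x , sym y≡fx)
  punchOut∘f-injective : Injective _≡_ _≡_ (λ x → punchOut (y≢f x))
  punchOut∘f-injective {x} {x′} eq = f-inj (punchOut-injective (y≢f x) (y≢f x′) eq)

transpose-matchˡ : ∀ {m} (i j : Fin m) → PC.transpose i j i ≡ j
transpose-matchˡ i j rewrite dec-true (i Fin.≟ i) refl = refl

transpose-matchʳ : ∀ {m} {i j : Fin m} → i ≢ j → PC.transpose i j j ≡ i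
transpose-matchʳ {i = i} {j} i≢j
  rewrite dec-false (j Fin.≟ i) (i≢j ∘ sym) | dec-true (j Fin.≟ j) refl = refl

-- Walks from start never revisit an edge, since nothing steps into start and ↦ is injective;
-- hence they take fewer than N steps and lying on one is decidable.
module Chain {N : ℕ} {_↦_ : Fin N → Fin N → Set} (_↦?_ : ∀ e f → Dec (e ↦ f))
             (↦-injective : ∀ {p q e} → p ↦ e → q ↦ e → p ≡ q)
             {start : Fin N} (start-initial : ∀ {p} → ¬ p ↦ start) where

  data Reach : ℕ → Fin N → Set where
    here : Reach zero start
    step : ∀ {t e f} → Reach t e → e ↦ f → Reach (suc t) f

  reach-injective : ∀ {s t e} → Reach s e → Reach t e → s ≡ t
  reach-injective here here = refl
  reach-injective here (step _ p↦start) = contradiction p↦start start-initial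
  reach-injective (step _ p↦start) here = contradiction p↦start start-initial
  reach-injective (step r p↦e) (step r′ q↦e) with ↦-injective p↦e q↦e
  ... | refl = cong suc (reach-injective r r′)

  reach-prefix : ∀ {s t e} → s ≤ t → Reach t e → ∃ (Reach s)
  reach-prefix s≤t r with m≤n⇒m<n∨m≡n s≤t
  reach-prefix s≤t r          | inj₂ refl = _ , r
  reach-prefix s≤t (step r _) | inj₁ s<t  = reach-prefix (≤-pred s<t) r

  reach-bound : ∀ {t e} → Reach t e → t < N
  reach-bound {t} r = injective⇒≤ visit-injective
    where
    visit : Fin (suc t) → Fin N
    visit s = proj₁ (reach-prefix (toℕ≤pred[n] s) r)
    visited : ∀ s → Reach (toℕ s) (visit s)
    visited s = proj₂ (reach-prefix (toℕ≤pred[n] s) r)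
    visit-injective : Injective _≡_ _≡_ visit
    visit-injective {s} {s′} eq = toℕ-injective (reach-injective (visited s) (subst (Reach _) (sym eq) (visited s′)))

  reach? : ∀ t e → Dec (Reach t e)
  reach? zero e = map′ (λ { refl → here }) (λ { here → refl }) (e Fin.≟ start)
  reach? (suc t) f = map′ (λ (e , r , e↦f) → step r e↦f) (λ { (step r e↦f) → _ , r , e↦f })
                          (any? λ e → reach? t e ×-dec (e ↦? f))

  OnChain : Fin N → Set
  OnChain e = ∃ λ t → Reach t e

  onChain? : ∀ e → Dec (OnChain e)
  onChain? e = map′ (λ (t , r) → toℕ t , r)
                    (λ (t , r) → fromℕ< (reach-bound r) , subst (λ s → Reach s e) (sym (toℕ-fromℕ< _)) r)
                    (any? λ t → reach? (toℕ t) e)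

  start-onChain : OnChain start
  start-onChain = zero , here

  onChain-step : ∀ {e f} → OnChain e → e ↦ f → OnChain f
  onChain-step (t , r) e↦f = suc t , step r e↦f

  onChain-predecessor : ∀ {f} → OnChain f → f ≢ start → ∃ λ e → OnChain e × e ↦ f
  onChain-predecessor (zero , here) f≢start = contradiction refl f≢start
  onChain-predecessor (suc t , step r e↦f) _ = _ , (t , r) , e↦f

module _ {a} {A : Set a} where

  tabulate↭punchIn : ∀ {n} (g : Fin (suc n) → A) j → tabulate g ↭ g j ∷ tabulate (g ∘ punchIn j)
  tabulate↭punchIn g zero = ↭-refl
  tabulate↭punchIn {suc n} g (suc j) =
    ↭-trans (↭-prep (g zero) (tabulate↭punchIn (g ∘ suc) j)) (↭-swap (g zero) (g (suc j)) ↭-refl)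

  tabulate-↭ : ∀ {n} {f g : Fin n → A} (σ : Fin n → Fin n) → Injective _≡_ _≡_ σ →
               (∀ i → f i ≡ g (σ i)) → tabulate f ↭ tabulate g
  tabulate-↭ {zero} σ σ-inj f≗g∘σ = ↭-refl
  tabulate-↭ {suc n} {f} {g} σ σ-inj f≗g∘σ =
    ↭-trans (↭-trans (↭-reflexive (cong (_∷ tabulate (f ∘ suc)) (f≗g∘σ zero)))
                     (↭-prep (g j) (tabulate-↭ σ′ σ′-injective f∘suc≗)))
            (↭-sym (tabulate↭punchIn g j))
    where
    j : Fin (suc n)
    j = σ zero
    j≢σsuc : ∀ i → j ≢ σ (suc i)
    j≢σsuc i = 0≢1+n ∘ σ-inj
    σ′ : Fin n → Fin n
    σ′ i = punchOut (j≢σsuc i)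
    σ′-injective : Injective _≡_ _≡_ σ′
    σ′-injective eq = suc-injective (σ-inj (punchOut-injective (j≢σsuc _) (j≢σsuc _) eq))
    f∘suc≗ : ∀ i → f (suc i) ≡ g (punchIn j (σ′ i))
    f∘suc≗ i = trans (f≗g∘σ (suc i)) (cong g (sym (punchIn-punchOut (j≢σsuc i))))

  record Enumeration {I : Set} (f : I → A) (xs : List A) : Set a where
    constructor enumeration
    field
      index : Fin (length xs) ↔ I
      lookup-index : ∀ k → lookup xs k ≡ f (to index k)

  reindex : ∀ {I J : Set} {f : I → A} {g : J → A} {xs} (ε : I ↔ J) → (∀ i → f i ≡ g (to ε i)) →
            Enumeration f xs → Enumeration g xs
  reindex ε f≗g∘ε (enumeration ι lookup≗f∘ι) =
    enumeration (ε ↔-∘ ι) λ k → trans (lookup≗f∘ι k) (f≗g∘ε (to ι k))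

  ↭-enumeration : ∀ {I : Set} {f : I → A} {xs ys} → xs ↭ ys → Enumeration f ys → Enumeration f xs
  ↭-enumeration xs↭ys (enumeration ι lookup≗f∘ι) =
    enumeration (ι ↔-∘ onIndices (↭⇒↭ₛ xs↭ys)) λ k → trans (onIndices-lookup (↭⇒↭ₛ xs↭ys) k) (lookup≗f∘ι _)
    where
    open Perm (setoid A) using (onIndices)
    open PermProperties (setoid A) using (onIndices-lookup)

  tabulate-enumeration : ∀ {n} (f : Fin n → A) → Enumeration f (tabulate f)
  tabulate-enumeration f = enumeration (cast-id (length-tabulate f)) (lookup-tabulate f)
    where
    lookup-tabulate : ∀ {n} (f : Fin n → A) k → lookup (tabulate f) k ≡ f (cast (length-tabulate f) k)
    lookup-tabulate {suc n} f zero = refl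
    lookup-tabulate {suc n} f (suc k) = lookup-tabulate (f ∘ suc) k

  lookup-++ : ∀ (xs ys : List A) k →
              lookup (xs ++ ys) k ≡ [ lookup xs , lookup ys ]′ (splitAt (length xs) (cast (length-++ xs) k))
  lookup-++ [] ys k = cong (lookup ys) (sym (cast-is-id refl k))
  lookup-++ (x ∷ xs) ys zero = refl
  lookup-++ (x ∷ xs) ys (suc k) =
    trans (lookup-++ xs ys k) (sym ([,]-map (splitAt (length xs) (cast (length-++ xs) k))))

  ++-enumeration : ∀ {I J : Set} {f : I → A} {g : J → A} {xs ys} →
                   Enumeration f xs → Enumeration g ys → Enumeration [ f , g ]′ (xs ++ ys)
  ++-enumeration {f = f} {g} {xs} {ys} (enumeration ι lookup≗f∘ι) (enumeration κ lookup≗g∘κ) =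
    enumeration ((ι ⊎-↔ κ) ↔-∘ (+↔⊎ ↔-∘ cast-id (length-++ xs))) λ k →
      trans (lookup-++ xs ys k) (lookup≗ (splitAt (length xs) (cast (length-++ xs) k)))
    where
    lookup≗ : ∀ s → [ lookup xs , lookup ys ]′ s ≡ [ f , g ]′ (to (ι ⊎-↔ κ) s)
    lookup≗ (inj₁ k) = lookup≗f∘ι k
    lookup≗ (inj₂ k) = lookup≗g∘κ k

  entries-enumeration : ∀ {m n} (M : Matrix A m n) → Enumeration (uncurry M) (entries M)
  entries-enumeration {zero} M = enumeration (mk↔ₛ′ (λ ()) (λ ()) (λ ()) (λ ())) λ ()
  entries-enumeration {suc m} {n} M =
    reindex firstRow⊎rest (λ { (inj₁ j) → refl ; (inj₂ (i , j)) → refl })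
      (++-enumeration (tabulate-enumeration (M zero)) (entries-enumeration (M ∘ suc)))
    where
    split : Fin (suc m) × Fin n → Fin n ⊎ (Fin m × Fin n)
    split (zero , j) = inj₁ j
    split (suc i , j) = inj₂ (i , j)
    firstRow⊎rest : (Fin n ⊎ (Fin m × Fin n)) ↔ (Fin (suc m) × Fin n)
    firstRow⊎rest = mk↔ₛ′ [ (zero ,_) , map₁ suc ]′ split
                          (λ { (zero , j) → refl ; (suc i , j) → refl }) (λ { (inj₁ j) → refl ; (inj₂ c) → refl })

  row-↭ : ∀ {m n} {M M′ : Matrix A m n} (ψ : (Fin m × Fin n) ↔ (Fin m × Fin n)) →
          (∀ c → proj₁ (to ψ c) ≡ proj₁ c) → (∀ c → uncurry M c ≡ uncurry M′ (to ψ c)) →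
          ∀ i → row M i ↭ row M′ i
  row-↭ {n = n} {M′ = M′} ψ keeps-row M≗M′∘ψ i =
    tabulate-↭ σ σ-injective λ j → trans (M≗M′∘ψ (i , j)) (cong (λ r → M′ r (σ j)) (keeps-row (i , j)))
    where
    σ : Fin n → Fin n
    σ j = proj₂ (to ψ (i , j))
    σ-injective : Injective _≡_ _≡_ σ
    σ-injective eq =
      cong proj₂ (Injection.injective (↔⇒↣ ψ) (×-≡,≡→≡ (trans (keeps-row _) (sym (keeps-row _)) , eq)))

  col-↭ : ∀ {m n} {M M′ : Matrix A m n} (ψ : (Fin m × Fin n) ↔ (Fin m × Fin n)) →
          (∀ c → proj₂ (to ψ c) ≡ proj₂ c) → (∀ c → uncurry M c ≡ uncurry M′ (to ψ c)) →
          ∀ j → col M j ↭ col M′ j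
  col-↭ ψ keeps-col M≗M′∘ψ =
    row-↭ (×-comm _ _ ↔-∘ (ψ ↔-∘ ×-comm _ _)) (keeps-col ∘ swap) (M≗M′∘ψ ∘ swap)

Colouring : ℕ → ℕ → Set
Colouring N m = Fin N → Maybe (Fin m)

_≟ᶜ_ : ∀ {m} (x y : Maybe (Fin m)) → Dec (x ≡ y)
_≟ᶜ_ = ≡-dec Fin._≟_

renamed≡just : ∀ {m} (τ : Permutation′ m) {x a} → Maybe.map (τ ⟨$⟩ʳ_) x ≡ just a → x ≡ just (τ ⟨$⟩ˡ a)
renamed≡just τ {just b} refl = cong just (sym (inverseˡ τ))

module _ {N m : ℕ} where

  Coloured : Colouring N m → Fin N → Set
  Coloured c e = ∃ λ a → c e ≡ just a

  assign : Fin N → Fin m → Colouring N m → Colouring N m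
  assign e a c f with f Fin.≟ e
  ... | yes _ = just a
  ... | no _  = c f

  assign-colours : ∀ e a c → Coloured (assign e a c) e
  assign-colours e a c with e Fin.≟ e
  ... | yes _ = a , refl
  ... | no e≢e = contradiction refl e≢e

  assign-keeps : ∀ e a c {f} → Coloured c f → Coloured (assign e a c) f
  assign-keeps e a c {f} f-coloured with f Fin.≟ e
  ... | yes _ = a , refl
  ... | no _  = f-coloured

  module _ {K : Fin N → Set} (K? : ∀ e → Dec (K e)) (τ : Permutation′ m) where

    renameOn : Colouring N m → Colouring N m
    renameOn c e with K? e
    ... | yes _ = Maybe.map (τ ⟨$⟩ʳ_) (c e)
    ... | no _  = c e

    renameOn-keeps : ∀ c {e} → Coloured c e → Coloured (renameOn c) e
    renameOn-keeps c {e} (a , e-colour) with K? e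
    ... | yes _ rewrite e-colour = τ ⟨$⟩ʳ a , refl
    ... | no _  = a , e-colour

-- An incidence S : Fin N ↔ Fin m × Fin n puts edge e at vertex proj₂ (to S e) in slot
-- proj₁ (to S e), so that every vertex has exactly m edges; two incidences L and R form an
-- m-regular bipartite multigraph.
module _ {N m n : ℕ} where

  vertex : Fin N ↔ (Fin m × Fin n) → Fin N → Fin n
  vertex S e = proj₂ (to S e)

  slot : Fin N ↔ (Fin m × Fin n) → Fin N → Fin m
  slot S e = proj₁ (to S e)

  place-injective : ∀ S {e f} → slot S e ≡ slot S f → vertex S e ≡ vertex S f → e ≡ f
  place-injective S eq eq′ = Injection.injective (↔⇒↣ S) (×-≡,≡→≡ (eq , eq′))

  Occurs : Fin N ↔ (Fin m × Fin n) → Colouring N m → Fin m → Fin n → Set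
  Occurs S c a j = ∃ λ e → vertex S e ≡ j × c e ≡ just a

  Free : Fin N ↔ (Fin m × Fin n) → Colouring N m → Fin m → Fin n → Set
  Free S c a j = ¬ Occurs S c a j

  occurs? : ∀ S c a j → Dec (Occurs S c a j)
  occurs? S c a j = any? λ e → (vertex S e Fin.≟ j) ×-dec (c e ≟ᶜ just a)

  ProperAt : Fin N ↔ (Fin m × Fin n) → Colouring N m → Set
  ProperAt S c = ∀ {e f a} → vertex S e ≡ vertex S f → c e ≡ just a → c f ≡ just a → e ≡ f

  all-occur⇒coloured : ∀ S c {j} → (∀ a → Occurs S c a j) → ∀ {e} → vertex S e ≡ j → Coloured c e
  all-occur⇒coloured S c {j} occurs {e} e-at-j =
    let a , slot-edge≡ = injective⇒strictlySurjective slot∘edge-injective (slot S e)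
    in a , trans (cong c (place-injective S (sym slot-edge≡) (trans e-at-j (sym (at-j a))))) (colour a)
    where
    edge : Fin m → Fin N
    edge a = proj₁ (occurs a)
    at-j : ∀ a → vertex S (edge a) ≡ j
    at-j a = proj₁ (proj₂ (occurs a))
    colour : ∀ a → c (edge a) ≡ just a
    colour a = proj₂ (proj₂ (occurs a))
    slot∘edge-injective : Injective _≡_ _≡_ (slot S ∘ edge)
    slot∘edge-injective {a} {b} eq = just-injective (trans (sym (colour a))
      (trans (cong c (place-injective S eq (trans (at-j a) (sym (at-j b))))) (colour b)))

  free-colour : ∀ S c {e} → c e ≡ nothing → ∃ λ a → Free S c a (vertex S e)
  free-colour S c {e} e-uncoloured with any? (λ a → ¬? (occurs? S c a (vertex S e)))
  ... | yes free = free
  ... | no ¬free = contradiction (trans (sym e-uncoloured) (proj₂ e-coloured)) λ ()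
    where
    e-coloured : Coloured c e
    e-coloured = all-occur⇒coloured S c (λ a → decidable-stable (occurs? S c a _) (¬free ∘ (a ,_))) refl

  assign-proper : ∀ S {c e a} → ProperAt S c → Free S c a (vertex S e) → ProperAt S (assign e a c)
  assign-proper S {c} {e} proper a-free {f} {f′} same-vertex f-colour f′-colour with f Fin.≟ e | f′ Fin.≟ e
  ... | yes refl | yes refl = refl
  ... | yes refl | no _     = contradiction (f′ , sym same-vertex , trans f′-colour (sym f-colour)) a-free
  ... | no _     | yes refl = contradiction (f , same-vertex , trans f-colour (sym f′-colour)) a-free
  ... | no _     | no _     = proper same-vertex f-colour f′-colour

  colour-incidence : ∀ S (c : Fin N → Fin m) → ProperAt S (just ∘ c) →
                     Σ (Fin N ↔ (Fin m × Fin n)) λ S′ → ∀ e → to S′ e ≡ (c e , vertex S e)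
  colour-incidence S c proper = mk↔ₛ′ place edge place∘edge edge∘place , λ _ → refl
    where
    place : Fin N → Fin m × Fin n
    place e = c e , vertex S e
    at : ∀ i j → to S (from S (i , j)) ≡ (i , j)
    at i j = strictlyInverseˡ S (i , j)
    colour-injective : ∀ j → Injective _≡_ _≡_ (λ i → c (from S (i , j)))
    colour-injective j {i} {i′} eq = begin
      i                         ≡⟨ cong proj₁ (at i j) ⟨
      slot S (from S (i , j))   ≡⟨ cong (slot S) same-edge ⟩
      slot S (from S (i′ , j))  ≡⟨ cong proj₁ (at i′ j) ⟩
      i′                        ∎
      where
      same-edge : from S (i , j) ≡ from S (i′ , j)
      same-edge = proper (trans (cong proj₂ (at i j)) (sym (cong proj₂ (at i′ j)))) (cong just eq) refl
    edge : Fin m × Fin n → Fin N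
    edge (a , j) = from S (proj₁ (injective⇒strictlySurjective (colour-injective j) a) , j)
    place∘edge : ∀ p → place (edge p) ≡ p
    place∘edge (a , j) =
      ×-≡,≡→≡ (proj₂ (injective⇒strictlySurjective (colour-injective j) a) , cong proj₂ (at _ j))
    edge∘place : ∀ e → edge (place e) ≡ e
    edge∘place e = let eq = place∘edge (place e) in proper (cong proj₂ eq) (cong (just ∘ proj₁) eq) refl

  module _ {K : Fin N → Set} (K? : ∀ e → Dec (K e)) (τ : Permutation′ m) where

    renameOn-proper : ∀ S {c} → ProperAt S c →
                      (∀ {e f} → K e → ¬ K f → vertex S e ≡ vertex S f → c f ≢ Maybe.map (τ ⟨$⟩ʳ_) (c e)) →
                      ProperAt S (renameOn K? τ c)
    renameOn-proper S {c} proper closed {e} {f} same-vertex e-colour f-colour with K? e | K? f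
    ... | yes _  | yes _  = proper same-vertex (renamed≡just τ e-colour) (renamed≡just τ f-colour)
    ... | yes e∈ | no f∉  = contradiction (trans f-colour (sym e-colour)) (closed e∈ f∉ same-vertex)
    ... | no e∉  | yes f∈ = contradiction (trans e-colour (sym f-colour)) (closed f∈ e∉ (sym same-vertex))
    ... | no _   | no _   = proper same-vertex e-colour f-colour

    renameOn-free : ∀ S {c a j} → (∀ {f} → vertex S f ≡ j → c f ≡ just a → K f) →
                    (∀ {f} → vertex S f ≡ j → c f ≡ just (τ ⟨$⟩ˡ a) → ¬ K f) →
                    Free S (renameOn K? τ c) a j
    renameOn-free S {c} a-only-on-K preimage-off-K (f , f-at-j , f-colour) with K? f
    ... | yes f∈ = preimage-off-K f-at-j (renamed≡just τ f-colour) f∈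
    ... | no f∉  = f∉ (a-only-on-K f-at-j f-colour)

module EdgeColouring {N m n : ℕ} (L R : Fin N ↔ (Fin m × Fin n)) where

  Proper : Colouring N m → Set
  Proper c = ProperAt L c × ProperAt R c

  module KempeSwap {c : Colouring N m} (proper-L : ProperAt L c) (proper-R : ProperAt R c)
                   {α β : Fin m} {x y : Fin n} (α-free : Free L c α x) (β-free : Free R c β y)
                   {a₁ : Fin N} (a₁-at-y : vertex R a₁ ≡ y) (a₁-colour : c a₁ ≡ just α) where

    α≢β : α ≢ β
    α≢β refl = β-free (a₁ , a₁-at-y , a₁-colour)

    not-α-and-β : ∀ {e} → c e ≡ just α → c e ≡ just β → ⊥
    not-α-and-β eα eβ = α≢β (just-injective (trans (sym eα) eβ))

    _↦_ : Fin N → Fin N → Set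
    e ↦ f = (c e ≡ just α × c f ≡ just β × vertex L e ≡ vertex L f)
          ⊎ (c e ≡ just β × c f ≡ just α × vertex R e ≡ vertex R f)

    _↦?_ : ∀ e f → Dec (e ↦ f)
    e ↦? f = ((c e ≟ᶜ just α) ×-dec (c f ≟ᶜ just β) ×-dec (vertex L e Fin.≟ vertex L f))
          ⊎-dec ((c e ≟ᶜ just β) ×-dec (c f ≟ᶜ just α) ×-dec (vertex R e Fin.≟ vertex R f))

    ↦-injective : ∀ {p q e} → p ↦ e → q ↦ e → p ≡ q
    ↦-injective (inj₁ (pα , _ , p~e)) (inj₁ (qα , _ , q~e)) = proper-L (trans p~e (sym q~e)) pα qα
    ↦-injective (inj₂ (pβ , _ , p~e)) (inj₂ (qβ , _ , q~e)) = proper-R (trans p~e (sym q~e)) pβ qβ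
    ↦-injective (inj₁ (_ , eβ , _)) (inj₂ (_ , eα , _)) = ⊥-elim (not-α-and-β eα eβ)
    ↦-injective (inj₂ (_ , eα , _)) (inj₁ (_ , eβ , _)) = ⊥-elim (not-α-and-β eα eβ)

    a₁-initial : ∀ {p} → ¬ p ↦ a₁
    a₁-initial (inj₁ (_ , a₁β , _)) = not-α-and-β a₁-colour a₁β
    a₁-initial (inj₂ (pβ , _ , p~a₁)) = β-free (_ , trans p~a₁ a₁-at-y , pβ)

    open Chain _↦?_ ↦-injective a₁-initial
      using (OnChain; onChain?; start-onChain; onChain-step; onChain-predecessor)

    β-predecessor : ∀ {f} → OnChain f → c f ≡ just β →
                    ∃ λ p → OnChain p × c p ≡ just α × vertex L p ≡ vertex L f
    β-predecessor f∈ fβ with onChain-predecessor f∈ (λ { refl → not-α-and-β a₁-colour fβ })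
    ... | p , p∈ , inj₁ (pα , _ , p~f) = p , p∈ , pα , p~f
    ... | _ , _  , inj₂ (_ , fα , _)   = ⊥-elim (not-α-and-β fα fβ)

    α-predecessor : ∀ {f} → OnChain f → c f ≡ just α → f ≢ a₁ →
                    ∃ λ p → OnChain p × c p ≡ just β × vertex R p ≡ vertex R f
    α-predecessor f∈ fα f≢a₁ with onChain-predecessor f∈ f≢a₁
    ... | p , p∈ , inj₂ (pβ , _ , p~f) = p , p∈ , pβ , p~f
    ... | _ , _  , inj₁ (_ , fβ , _)   = ⊥-elim (not-α-and-β fα fβ)

    onChain-colour : ∀ {e} → OnChain e → c e ≡ just α ⊎ c e ≡ just β
    onChain-colour {e} e∈ with e Fin.≟ a₁
    ... | yes refl = inj₁ a₁-colour
    ... | no e≢a₁ with onChain-predecessor e∈ e≢a₁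
    ...   | _ , _ , inj₁ (_ , eβ , _) = inj₂ eβ
    ...   | _ , _ , inj₂ (_ , eα , _) = inj₁ eα

    τ : Permutation′ m
    τ = transpose α β

    τ-α : ∀ {e} → c e ≡ just α → Maybe.map (τ ⟨$⟩ʳ_) (c e) ≡ just β
    τ-α eα rewrite eα = cong just (transpose-matchˡ α β)

    τ-β : ∀ {e} → c e ≡ just β → Maybe.map (τ ⟨$⟩ʳ_) (c e) ≡ just α
    τ-β eβ rewrite eβ = cong just (transpose-matchʳ α≢β)

    closed-L : ∀ {e f} → OnChain e → ¬ OnChain f → vertex L e ≡ vertex L f → c f ≢ Maybe.map (τ ⟨$⟩ʳ_) (c e)
    closed-L e∈ f∉ e~f f-colour with onChain-colour e∈
    ... | inj₁ eα = f∉ (onChain-step e∈ (inj₁ (eα , trans f-colour (τ-α eα) , e~f)))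
    ... | inj₂ eβ with β-predecessor e∈ eβ
    ...   | p , p∈ , pα , p~e = f∉ (subst OnChain (proper-L (trans p~e e~f) pα (trans f-colour (τ-β eβ))) p∈)

    closed-R : ∀ {e f} → OnChain e → ¬ OnChain f → vertex R e ≡ vertex R f → c f ≢ Maybe.map (τ ⟨$⟩ʳ_) (c e)
    closed-R {e} {f} e∈ f∉ e~f f-colour with onChain-colour e∈
    ... | inj₂ eβ = f∉ (onChain-step e∈ (inj₂ (eβ , trans f-colour (τ-β eβ) , e~f)))
    ... | inj₁ eα with e Fin.≟ a₁
    ...   | yes refl = β-free (f , trans (sym e~f) a₁-at-y , trans f-colour (τ-α eα))
    ...   | no e≢a₁ with α-predecessor e∈ eα e≢a₁
    ...     | p , p∈ , pβ , p~e = f∉ (subst OnChain (proper-R (trans p~e e~f) pβ (trans f-colour (τ-α eα))) p∈)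

    swapped : Colouring N m
    swapped = renameOn onChain? τ c

    swapped-proper : Proper swapped
    swapped-proper =
      renameOn-proper onChain? τ L proper-L closed-L , renameOn-proper onChain? τ R proper-R closed-R

    swapped-keeps : ∀ {e} → Coloured c e → Coloured swapped e
    swapped-keeps = renameOn-keeps onChain? τ c

    τ⁻¹α≡β : τ ⟨$⟩ˡ α ≡ β
    τ⁻¹α≡β = transpose-matchʳ (α≢β ∘ sym)

    α-free-at-x : Free L swapped α x
    α-free-at-x = renameOn-free onChain? τ L
      (λ f-at-x fα → ⊥-elim (α-free (_ , f-at-x , fα)))
      (λ f-at-x fβ f∈ → let p , _ , pα , p~f = β-predecessor f∈ (trans fβ (cong just τ⁻¹α≡β))
                       in α-free (p , trans p~f f-at-x , pα))

    α-free-at-y : Free R swapped α y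
    α-free-at-y = renameOn-free onChain? τ R
      (λ f-at-y fα → subst OnChain (proper-R (trans a₁-at-y (sym f-at-y)) a₁-colour fα) start-onChain)
      (λ f-at-y fβ _ → β-free (_ , f-at-y , trans fβ (cong just τ⁻¹α≡β)))

  Extension : Colouring N m → Fin N → Set
  Extension c e = ∃ λ c′ → Proper c′ × Coloured c′ e × (∀ {f} → Coloured c f → Coloured c′ f)

  assign-extension : ∀ {c c′ e a} → Proper c′ → Free L c′ a (vertex L e) → Free R c′ a (vertex R e) →
                     (∀ {f} → Coloured c f → Coloured c′ f) → Extension c e
  assign-extension {c′ = c′} {e} {a} (proper-L , proper-R) a-free-L a-free-R keeps =
    assign e a c′ , (assign-proper L proper-L a-free-L , assign-proper R proper-R a-free-R) ,
    assign-colours e a c′ , assign-keeps e a c′ ∘ keeps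

  extend : ∀ {c} → Proper c → ∀ e → Extension c e
  extend {c} proper e with c e in e-colour
  ... | just a = c , proper , (a , e-colour) , id
  ... | nothing with free-colour L c e-colour | free-colour R c e-colour
  ... | α , α-free | β , β-free with occurs? R c α (vertex R e)
  ... | no α-free-R = assign-extension proper α-free α-free-R id
  ... | yes (a₁ , a₁-at , a₁-colour) =
    assign-extension swapped-proper α-free-at-x α-free-at-y swapped-keeps
    where open KempeSwap (proj₁ proper) (proj₂ proper) α-free β-free a₁-at a₁-colour

  colour-all : ∀ es → ∃ λ c → Proper c × All (Coloured c) es
  colour-all [] = (λ _ → nothing) , ((λ _ ()) , (λ _ ())) , []
  colour-all (e ∷ es) with colour-all es
  ... | c , proper , coloured with extend proper e
  ...   | c′ , proper′ , e-coloured , keeps = c′ , proper′ , e-coloured ∷ All.map keeps coloured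

  proper-colouring : ∃ λ (c : Fin N → Fin m) → Proper (just ∘ c)
  proper-colouring with colour-all (allFin N)
  ... | c , (proper-L , proper-R) , coloured = total , total-proper L proper-L , total-proper R proper-R
    where
    total : Fin N → Fin m
    total e = proj₁ (All.lookup coloured (∈-allFin e))
    c≡total : ∀ e → c e ≡ just (total e)
    c≡total e = proj₂ (All.lookup coloured (∈-allFin e))
    total-proper : ∀ S → ProperAt S c → ProperAt S (just ∘ total)
    total-proper _ proper same-vertex e-colour f-colour =
      proper same-vertex (trans (c≡total _) e-colour) (trans (c≡total _) f-colour)

  record Reslotting : Set where
    field
      L′ R′ : Fin N ↔ (Fin m × Fin n)
      vertex-L′ : ∀ e → vertex L′ e ≡ vertex L e
      vertex-R′ : ∀ e → vertex R′ e ≡ vertex R e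
      slot-L′≡slot-R′ : ∀ e → slot L′ e ≡ slot R′ e

    vertex-from-L′ : ∀ p → vertex L (from L′ p) ≡ proj₂ p
    vertex-from-L′ p = trans (sym (vertex-L′ _)) (cong proj₂ (strictlyInverseˡ L′ p))

    vertex-from-R′ : ∀ p → vertex R (from R′ p) ≡ proj₂ p
    vertex-from-R′ p = trans (sym (vertex-R′ _)) (cong proj₂ (strictlyInverseˡ R′ p))

    slot-from-L′ : ∀ p → slot R′ (from L′ p) ≡ proj₁ p
    slot-from-L′ p = trans (sym (slot-L′≡slot-R′ _)) (cong proj₁ (strictlyInverseˡ L′ p))

  kőnig : Reslotting
  kőnig with proper-colouring
  ... | c , proper-L , proper-R with colour-incidence L c proper-L | colour-incidence R c proper-R
  ...   | L′ , to-L′ | R′ , to-R′ = record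
    { L′ = L′ ; R′ = R′
    ; vertex-L′ = cong proj₂ ∘ to-L′ ; vertex-R′ = cong proj₂ ∘ to-R′
    ; slot-L′≡slot-R′ = λ e → trans (cong proj₁ (to-L′ e)) (sym (cong proj₁ (to-R′ e)))
    }

lemma2p5 : ∀ {a} {A : Set a} (m n : ℕ) (P Q : Matrix A m n) →
           SameMultiset (entries P) (entries Q) →
           Σ (Matrix A m n) λ P′ → Σ (Matrix A m n) λ Q′ →
             ((i : Fin m) → SameMultiset (row P′ i) (row Q′ i)) ×
             ((j : Fin n) → SameMultiset (col P′ j) (col P j) × SameMultiset (col Q′ j) (col Q j))
lemma2p5 {A = A} m n P Q entries-P↭Q = P′ , Q′ , rows , λ j → columns-P j , columns-Q j
  where
  open Enumeration (entries-enumeration P) renaming (index to ιP; lookup-index to lookup-P)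
  open Enumeration (↭-enumeration entries-P↭Q (entries-enumeration Q))
    renaming (index to ιQ; lookup-index to lookup-Q)
  open EdgeColouring.Reslotting (EdgeColouring.kőnig ιP ιQ)

  same-entry : ∀ e → uncurry P (to ιP e) ≡ uncurry Q (to ιQ e)
  same-entry e = trans (sym (lookup-P e)) (lookup-Q e)

  -- Cell (i , j) holds the entry at column j whose edge has colour i.
  P′ Q′ : Matrix A m n
  P′ i j = uncurry P (to ιP (from L′ (i , j)))
  Q′ i j = uncurry Q (to ιQ (from R′ (i , j)))

  rows : ∀ i → row P′ i ↭ row Q′ i
  rows = row-↭ (R′ ↔-∘ ↔-sym L′) slot-from-L′
           λ p → trans (same-entry _) (cong (uncurry Q ∘ to ιQ) (sym (strictlyInverseʳ R′ _)))

  columns-P : ∀ j → col P′ j ↭ col P j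
  columns-P = col-↭ (ιP ↔-∘ ↔-sym L′) vertex-from-L′ λ _ → refl

  columns-Q : ∀ j → col Q′ j ↭ col Q j
  columns-Q = col-↭ (ιQ ↔-∘ ↔-sym R′) vertex-from-R′ λ _ → refl
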